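{- Let $d\ge 2$ be an integer, let $c:V(G)\to\{1,\ldots,d\}$ be a proper $d$-coloring of an undirected graph $G$, and let $T_G$ be a fixed $(k,l)$-tree in $G$ with $k\ge1$. Let $x=\lfloor\frac{d+(l/k)(d-1)}{2}\rceil$ (rounding to a nearest integer). Then there is a set $S$ of $x$ colors such that, if we put $V_1=c^{ -1}(S)$ and $V_2=V(G)\setminus V_1$, then \[|\mathrm{la}(T_G)|\le \left( 1 - \frac{x(d-x)}{d(d-1)}\right) k + \left(1-\frac{x}{d}\right)l.\] In particular, $|\mathrm{la}(T_G)| \le \left(1 - \frac{\lfloor d/2\rfloor \lceil d/2\rceil}{d(d-1)}\right)k + \frac{l}{2}$.
   Context: A $(k,l)$-tree in $G$ is a subgraph of $G$ that is a tree with exactly $k$ vertices, exactly $l$ of which are leaves. For a bipartition $V(G)=V_1\cup V_2$ and a subtree $T$ of $G$, with $L(T)$ its leaves and $I(T)=V(T)\setminus L(T)$ its internal vertices, $\mathrm{la}(T)=L(T)\cup (I(T)\cap V_1)\cup\{uv\in E(T) : u,v\in V_2\}$. -}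

module Defs where

open import Data.Nat using (ℕ; zero; suc; _+_; _≡ᵇ_)
open import Data.Bool using (Bool; true; false; if_then_else_; _∧_; not)
open import Data.Fin using (Fin; zero; suc; _<?_)
open import Relation.Nullary using (does; ¬_)
open import Relation.Binary.PropositionalEquality using (_≡_)
open import Function using (_∘_)
open import Function.Definitions using (Injective)

count : ∀ {n} → (Fin n → Bool) → ℕ
count {zero}  p = 0
count {suc n} p = (if p zero then 1 else 0) + count (p ∘ suc)

record Graph : Set₁ where
  field
    V   : Set
    Adj : V → V → Set
    sym : ∀ {u v} → Adj u v → Adj v u
open Graph public

Proper : (G : Graph) (d : ℕ) → (V G → Fin d) → Set
Proper G d c = ∀ {u v} → Adj G u v → ¬ (c u ≡ c v)

data Reach {k : ℕ} (E : Fin k → Fin k → Bool) : Fin k → Fin k → Set where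
  here : ∀ {i} → Reach E i i
  step : ∀ {i j m} → E i j ≡ true → Reach E j m → Reach E i m

sumF : ∀ {n} → (Fin n → ℕ) → ℕ
sumF {zero}  f = 0
sumF {suc n} f = f zero + sumF (f ∘ suc)

edgesWith : ∀ {k} → (Fin k → Fin k → Bool) → (Fin k → Fin k → Bool) → ℕ
edgesWith E q = sumF (λ i → count (λ j → does (i <? j) ∧ E i j ∧ q i j))

numEdges : ∀ {k} → (Fin k → Fin k → Bool) → ℕ
numEdges E = edgesWith E (λ _ _ → true)

-- A subtree of G with exactly k vertices: vertices embedded injectively by
-- `vert`, edges given by a symmetric irreflexive relation `E` on Fin k, every
-- edge of which is an edge of G; tree = connected with k - 1 edges.
record Subtree (G : Graph) (k : ℕ) : Set where
  field
    vert      : Fin k → V G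
    vert-inj  : Injective _≡_ _≡_ vert
    E         : Fin k → Fin k → Bool
    E-sym     : ∀ i j → E i j ≡ E j i
    E-irrefl  : ∀ i → E i i ≡ false
    E-sub     : ∀ i j → E i j ≡ true → Adj G (vert i) (vert j)
    connected : ∀ i j → Reach E i j
    edges     : numEdges E + 1 ≡ k
open Subtree public

deg : ∀ {G k} → Subtree G k → Fin k → ℕ
deg T i = count (E T i)

isLeaf : ∀ {G k} → Subtree G k → Fin k → Bool
isLeaf T i = deg T i ≡ᵇ 1

numLeaves : ∀ {G k} → Subtree G k → ℕ
numLeaves T = count (isLeaf T)

-- |la(T)| for the bipartition V1 = c⁻¹(S), V2 = V(G) \ V1, where S ⊆ colours.
laSize : ∀ {G k d} → Subtree G k → (V G → Fin d) → (Fin d → Bool) → ℕ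
laSize T c S =
  numLeaves T
  + count (λ i → not (isLeaf T i) ∧ inV1 i)
  + edgesWith (E T) (λ i j → not (inV1 i) ∧ not (inV1 j))
  where
  inV1 = λ i → S (c (vert T i))

-- Average |la(T)| over all colour sets S of size x. A leaf always counts; an internal
-- vertex counts iff its colour is in S, which happens for x/d of the sets; an edge counts
-- iff both endpoint colours avoid S, and since the colouring is proper the two colours are
-- distinct, so this happens for (d-x)(d-x-1)/(d(d-1)) of the sets. With k - l internal
-- vertices and k - 1 edges the average is at most the claimed bound, and some S attains
-- at most the average. The second bound is the case x = d - ⌊d/2⌋.

module Submission where

open import Defs hiding (sym)
open import Data.Bool using (Bool; true; false; if_then_else_; _∧_; not)
open import Data.Bool.Properties using (∧-comm)
open import Data.Empty using (⊥-elim)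
open import Data.Fin using (Fin; zero; suc; _<?_)
open import Data.List using (List; []; _∷_; [_]; _++_; map; length)
open import Data.List.Properties using (map-++; map-cong; map-∘; length-++; length-map)
open import Data.List.Relation.Unary.All as All using (All; []; _∷_)
open import Data.List.Relation.Unary.All.Properties using (map⁺; ++⁺)
import Data.List.Extrema
import Algebra.Properties.CommutativeSemigroup as CommSemigroupProperties
open import Data.Nat using (ℕ; zero; suc; _+_; _*_; _∸_; _/_; _≤_; _<_; z≤n; s≤s; NonZero; >-nonZero)
open import Data.Nat.DivMod using (m/n≤m; m/n*n≤m)
open import Data.Nat.Combinatorics using (_C_; nCk+nC[k+1]≡[n+1]C[k+1]; nC1≡n; k>n⇒nCk≡0)
open import Data.Nat.ListAction using (sum)
open import Data.Nat.ListAction.Properties using (sum-++)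
open import Data.Nat.Properties hiding (_<?_)
open import Data.Nat.Tactic.RingSolver using (solve-∀)
open import Data.Product using (Σ; _×_; _,_)
open import Data.Sum using (_⊎_; inj₁; inj₂)
open import Data.Vec.Functional using () renaming (_∷_ to _∷ᵛ_)
open import Function using (_∘_)
open import Relation.Nullary using (does)
open import Relation.Binary.PropositionalEquality using (_≡_; _≢_; refl; sym; trans; cong; cong₂; subst; subst₂; module ≡-Reasoning)

ind : Bool → ℕ
ind b = if b then 1 else 0

∑ : {A : Set} → List A → (A → ℕ) → ℕ
∑ L f = sum (map f L)

module _ {A : Set} where

  ∑-cong : ∀ L {f g : A → ℕ} → (∀ a → f a ≡ g a) → ∑ L f ≡ ∑ L g
  ∑-cong L f≗g = cong sum (map-cong f≗g L)

  ∑-++ : ∀ L M (f : A → ℕ) → ∑ (L ++ M) f ≡ ∑ L f + ∑ M f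
  ∑-++ L M f = trans (cong sum (map-++ f L M)) (sum-++ (map f L) (map f M))

  ∑-map : ∀ {B : Set} (g : B → A) L (f : A → ℕ) → ∑ (map g L) f ≡ ∑ L (f ∘ g)
  ∑-map g L f = cong sum (sym (map-∘ L))

  ∑-+ : ∀ L (f g : A → ℕ) → ∑ L (λ a → f a + g a) ≡ ∑ L f + ∑ L g
  ∑-+ []      f g = refl
  ∑-+ (a ∷ L) f g = trans (cong (f a + g a +_) (∑-+ L f g)) (+-+-comm (f a) (g a) _ _)
    where
    +-+-comm : ∀ p q r s → p + q + (r + s) ≡ p + r + (q + s)
    +-+-comm = solve-∀

  ∑-const : ∀ L m → ∑ L (λ (_ : A) → m) ≡ length L * m
  ∑-const []      m = refl
  ∑-const (a ∷ L) m = cong (m +_) (∑-const L m)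

  ∑-zero : ∀ L → ∑ L (λ (_ : A) → 0) ≡ 0
  ∑-zero L = trans (∑-const L 0) (*-zeroʳ (length L))

  ∑-one : ∀ L → ∑ L (λ (_ : A) → 1) ≡ length L
  ∑-one L = trans (∑-const L 1) (*-identityʳ (length L))

  ∑-ind-∧ : ∀ L b (p : A → Bool) → ∑ L (λ a → ind (b ∧ p a)) ≡ ind b * ∑ L (ind ∘ p)
  ∑-ind-∧ L true  p = sym (+-identityʳ _)
  ∑-ind-∧ L false p = ∑-zero L

  ∑-ind+∑-ind-not : ∀ L (p : A → Bool) → ∑ L (ind ∘ p) + ∑ L (λ a → ind (not (p a))) ≡ length L
  ∑-ind+∑-ind-not L p = begin
      ∑ L (ind ∘ p) + ∑ L (λ a → ind (not (p a)))
    ≡⟨ ∑-+ L (ind ∘ p) (λ a → ind (not (p a))) ⟨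
      ∑ L (λ a → ind (p a) + ind (not (p a)))
    ≡⟨ ∑-cong L (λ a → ind+ind-not (p a)) ⟩
      ∑ L (λ _ → 1)
    ≡⟨ ∑-one L ⟩
      length L ∎
    where
    open ≡-Reasoning
    ind+ind-not : ∀ b → ind b + ind (not b) ≡ 1
    ind+ind-not true  = refl
    ind+ind-not false = refl

  length*≤∑ : ∀ {m} (f : A → ℕ) {L} → All (λ a → m ≤ f a) L → length L * m ≤ ∑ L f
  length*≤∑ f []         = z≤n
  length*≤∑ f (m≤ ∷ m≤s) = +-mono-≤ m≤ (length*≤∑ f m≤s)

  length*argmin≤∑ : ∀ {P : A → Set} (f : A → ℕ) L → 0 < length L → All P L →
                    Σ A λ S → P S × length L * f S ≤ ∑ L f
  length*argmin≤∑ f (a ∷ L) _ (Pa ∷ PL) =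
    argmin f a L , argmin-all f Pa PL , length*≤∑ f (f[argmin]≤f[⊤] {f = f} a L ∷ f[argmin]≤f[xs] {f = f} a L)
    where open Data.List.Extrema ≤-totalOrder

count≡sumF : ∀ {n} (p : Fin n → Bool) → count p ≡ sumF (ind ∘ p)
count≡sumF {zero}  p = refl
count≡sumF {suc n} p = cong (ind (p zero) +_) (count≡sumF (p ∘ suc))

sumF-cong : ∀ {n} {f g : Fin n → ℕ} → (∀ i → f i ≡ g i) → sumF f ≡ sumF g
sumF-cong {zero}  f≗g = refl
sumF-cong {suc n} f≗g = cong₂ _+_ (f≗g zero) (sumF-cong (f≗g ∘ suc))

sumF-*ʳ : ∀ {n} (f : Fin n → ℕ) m → sumF (λ i → f i * m) ≡ sumF f * m
sumF-*ʳ {zero}  f m = refl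
sumF-*ʳ {suc n} f m = trans (cong (f zero * m +_) (sumF-*ʳ (f ∘ suc) m))
                            (sym (*-distribʳ-+ m (f zero) (sumF (f ∘ suc))))

∑-sumF-comm : ∀ {A : Set} {n} L (g : A → Fin n → ℕ) →
              ∑ L (λ a → sumF (g a)) ≡ sumF (λ i → ∑ L (λ a → g a i))
∑-sumF-comm {n = zero}  L g = ∑-zero L
∑-sumF-comm {n = suc n} L g = trans (∑-+ L (λ a → g a zero) (λ a → sumF (g a ∘ suc)))
                                    (cong (∑ L (λ a → g a zero) +_) (∑-sumF-comm L (λ a → g a ∘ suc)))

count-cong : ∀ {n} {p q : Fin n → Bool} → (∀ i → p i ≡ q i) → count p ≡ count q
count-cong {p = p} {q} p≗q = trans (count≡sumF p) (trans (sumF-cong (cong ind ∘ p≗q)) (sym (count≡sumF q)))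

count-not+count : ∀ {n} (p : Fin n → Bool) → count (not ∘ p) + count p ≡ n
count-not+count {zero}  p = refl
count-not+count {suc n} p with p zero
... | true  = trans (+-suc _ _) (cong suc (count-not+count (p ∘ suc)))
... | false = cong suc (count-not+count (p ∘ suc))

count-false : ∀ n → count {n} (λ _ → false) ≡ 0
count-false zero    = refl
count-false (suc n) = count-false n

∑-count-∧ : ∀ {A : Set} {n m} L (p : Fin n → Bool) (P : A → Fin n → Bool) →
            (∀ i → p i ≡ true → ∑ L (λ a → ind (P a i)) ≡ m) →
            ∑ L (λ a → count (λ i → p i ∧ P a i)) ≡ count p * m
∑-count-∧ {m = m} L p P ∑P≡m = begin
    ∑ L (λ a → count (λ i → p i ∧ P a i))
  ≡⟨ ∑-cong L (λ a → count≡sumF (λ i → p i ∧ P a i)) ⟩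
    ∑ L (λ a → sumF (λ i → ind (p i ∧ P a i)))
  ≡⟨ ∑-sumF-comm L (λ a i → ind (p i ∧ P a i)) ⟩
    sumF (λ i → ∑ L (λ a → ind (p i ∧ P a i)))
  ≡⟨ sumF-cong (λ i → trans (∑-ind-∧ L (p i) (λ a → P a i)) (ind*-cong (p i) (∑P≡m i))) ⟩
    sumF (λ i → ind (p i) * m)
  ≡⟨ sumF-*ʳ (ind ∘ p) m ⟩
    sumF (ind ∘ p) * m
  ≡⟨ cong (_* m) (count≡sumF p) ⟨
    count p * m ∎
  where
  open ≡-Reasoning
  ind*-cong : ∀ b {s} → (b ≡ true → s ≡ m) → ind b * s ≡ ind b * m
  ind*-cong true  s≡m = cong (_+ 0) (s≡m refl)
  ind*-cong false _   = refl

subsetsOfSize : (d x : ℕ) → List (Fin d → Bool)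
subsetsOfSize d       zero    = [ (λ _ → false) ]
subsetsOfSize zero    (suc x) = []
subsetsOfSize (suc d) (suc x) =
  map (false ∷ᵛ_) (subsetsOfSize d (suc x)) ++ map (true ∷ᵛ_) (subsetsOfSize d x)

∑-subsetsOfSize-suc : ∀ d x (f : (Fin (suc d) → Bool) → ℕ) →
  ∑ (subsetsOfSize (suc d) (suc x)) f
    ≡ ∑ (subsetsOfSize d (suc x)) (f ∘ (false ∷ᵛ_)) + ∑ (subsetsOfSize d x) (f ∘ (true ∷ᵛ_))
∑-subsetsOfSize-suc d x f =
  trans (∑-++ (map (false ∷ᵛ_) (subsetsOfSize d (suc x))) _ f)
        (cong₂ _+_ (∑-map (false ∷ᵛ_) (subsetsOfSize d (suc x)) f)
                   (∑-map (true ∷ᵛ_) (subsetsOfSize d x) f))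

pascal : ∀ n k → n C suc k + n C k ≡ suc n C suc k
pascal n k = trans (+-comm (n C suc k) (n C k)) (nCk+nC[k+1]≡[n+1]C[k+1] n k)

length-subsetsOfSize : ∀ d x → length (subsetsOfSize d x) ≡ d C x
length-subsetsOfSize d       zero    = refl
length-subsetsOfSize zero    (suc x) = refl
length-subsetsOfSize (suc d) (suc x) = begin
    length (map (false ∷ᵛ_) (subsetsOfSize d (suc x)) ++ map (true ∷ᵛ_) (subsetsOfSize d x))
  ≡⟨ length-++ (map (false ∷ᵛ_) (subsetsOfSize d (suc x))) ⟩
    length (map (false ∷ᵛ_) (subsetsOfSize d (suc x))) + length (map (true ∷ᵛ_) (subsetsOfSize d x))
  ≡⟨ cong₂ _+_ (length-map (false ∷ᵛ_) (subsetsOfSize d (suc x))) (length-map (true ∷ᵛ_) (subsetsOfSize d x)) ⟩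
    length (subsetsOfSize d (suc x)) + length (subsetsOfSize d x)
  ≡⟨ cong₂ _+_ (length-subsetsOfSize d (suc x)) (length-subsetsOfSize d x) ⟩
    d C suc x + d C x
  ≡⟨ pascal d x ⟩
    suc d C suc x ∎
  where open ≡-Reasoning

count-subsetsOfSize : ∀ d x → All (λ S → count S ≡ x) (subsetsOfSize d x)
count-subsetsOfSize d       zero    = count-false d ∷ []
count-subsetsOfSize zero    (suc x) = []
count-subsetsOfSize (suc d) (suc x) =
  ++⁺ (map⁺ (count-subsetsOfSize d (suc x))) (map⁺ (All.map (cong suc) (count-subsetsOfSize d x)))

∑-avoiding : ∀ n x (a : Fin (suc n)) →
             ∑ (subsetsOfSize (suc n) x) (λ S → ind (not (S a))) ≡ n C x
∑-avoiding n       zero    a       = refl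
∑-avoiding n       (suc x) zero    =
  trans (∑-subsetsOfSize-suc n x _)
        (trans (cong₂ _+_ (trans (∑-one (subsetsOfSize n (suc x))) (length-subsetsOfSize n (suc x)))
                           (∑-zero (subsetsOfSize n x)))
               (+-identityʳ _))
∑-avoiding (suc n) (suc x) (suc a) =
  trans (∑-subsetsOfSize-suc (suc n) x _)
        (trans (cong₂ _+_ (∑-avoiding n (suc x) a) (∑-avoiding n x a)) (pascal n x))

∑-avoiding-zero : ∀ n x (b : Fin (suc n)) →
  ∑ (subsetsOfSize (suc (suc n)) x) (λ S → ind (not (S zero) ∧ not (S (suc b)))) ≡ n C x
∑-avoiding-zero n zero    b = refl
∑-avoiding-zero n (suc x) b =
  trans (∑-subsetsOfSize-suc (suc n) x _)
        (trans (cong₂ _+_ (∑-avoiding n (suc x) b) (∑-zero (subsetsOfSize (suc n) x))) (+-identityʳ _))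

∑-avoiding₂ : ∀ n x (a b : Fin (suc (suc n))) → a ≢ b →
  ∑ (subsetsOfSize (suc (suc n)) x) (λ S → ind (not (S a) ∧ not (S b))) ≡ n C x
∑-avoiding₂ n       zero    a             b             a≢b = refl
∑-avoiding₂ n       (suc x) zero          zero          a≢b = ⊥-elim (a≢b refl)
∑-avoiding₂ n       (suc x) zero          (suc b)       a≢b = ∑-avoiding-zero n (suc x) b
∑-avoiding₂ n       (suc x) (suc a)       zero          a≢b =
  trans (∑-cong (subsetsOfSize (suc (suc n)) (suc x)) (λ S → cong ind (∧-comm (not (S (suc a))) (not (S zero)))))
        (∑-avoiding-zero n (suc x) a)
∑-avoiding₂ zero    (suc x) (suc zero)    (suc zero)    a≢b = ⊥-elim (a≢b refl)
∑-avoiding₂ (suc n) (suc x) (suc a)       (suc b)       a≢b =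
  trans (∑-subsetsOfSize-suc (suc (suc n)) x _)
        (trans (cong₂ _+_ (∑-avoiding₂ n (suc x) a b a≢b′) (∑-avoiding₂ n x a b a≢b′)) (pascal n x))
  where
  a≢b′ : a ≢ b
  a≢b′ = a≢b ∘ cong suc

∑-containing : ∀ n x (a : Fin (suc n)) →
               ∑ (subsetsOfSize (suc n) x) (λ S → ind (S a)) ≡ suc n C x ∸ n C x
∑-containing n x a = begin
    ∑ L (λ S → ind (S a))
  ≡⟨ m+n∸n≡m _ (n C x) ⟨
    ∑ L (λ S → ind (S a)) + n C x ∸ n C x
  ≡⟨ cong (λ m → ∑ L (λ S → ind (S a)) + m ∸ n C x) (∑-avoiding n x a) ⟨
    ∑ L (λ S → ind (S a)) + ∑ L (λ S → ind (not (S a))) ∸ n C x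
  ≡⟨ cong (_∸ n C x) (trans (∑-ind+∑-ind-not L (λ S → S a)) (length-subsetsOfSize (suc n) x)) ⟩
    suc n C x ∸ n C x ∎
  where
  open ≡-Reasoning
  L : List (Fin (suc n) → Bool)
  L = subsetsOfSize (suc n) x

[1+n]*nCk≡[1+k]*[1+n]C[1+k] : ∀ n k → suc n * (n C k) ≡ suc k * (suc n C suc k)
[1+n]*nCk≡[1+k]*[1+n]C[1+k] zero    zero    = refl
[1+n]*nCk≡[1+k]*[1+n]C[1+k] zero    (suc k) =
  sym (trans (cong (suc (suc k) *_) (k>n⇒nCk≡0 {1} {suc (suc k)} (s≤s (s≤s z≤n)))) (*-zeroʳ (suc (suc k))))
[1+n]*nCk≡[1+k]*[1+n]C[1+k] (suc n) zero    =
  trans (*-identityʳ (suc (suc n))) (sym (trans (+-identityʳ _) (nC1≡n (suc (suc n)))))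
[1+n]*nCk≡[1+k]*[1+n]C[1+k] (suc n) (suc k) = begin
    suc (suc n) * (suc n C suc k)
  ≡⟨ cong (suc (suc n) *_) (pascal n k) ⟨
    suc (suc n) * (n C suc k + n C k)
  ≡⟨ split n (n C suc k) (n C k) ⟩
    suc n * (n C suc k) + (suc n * (n C k) + n C suc k + n C k)
  ≡⟨ cong₂ (λ u v → u + (v + n C suc k + n C k))
           ([1+n]*nCk≡[1+k]*[1+n]C[1+k] n (suc k)) ([1+n]*nCk≡[1+k]*[1+n]C[1+k] n k) ⟩
    suc (suc k) * (suc n C suc (suc k)) + (suc k * (suc n C suc k) + n C suc k + n C k)
  ≡⟨ cong (λ u → suc (suc k) * (suc n C suc (suc k)) + (suc k * u + n C suc k + n C k)) (pascal n k) ⟨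
    suc (suc k) * (suc n C suc (suc k)) + (suc k * (n C suc k + n C k) + n C suc k + n C k)
  ≡⟨ merge k (suc n C suc (suc k)) (n C suc k) (n C k) ⟩
    suc (suc k) * (suc n C suc (suc k) + (n C suc k + n C k))
  ≡⟨ cong (λ u → suc (suc k) * (suc n C suc (suc k) + u)) (pascal n k) ⟩
    suc (suc k) * (suc n C suc (suc k) + suc n C suc k)
  ≡⟨ cong (suc (suc k) *_) (pascal (suc n) (suc k)) ⟩
    suc (suc k) * (suc (suc n) C suc (suc k)) ∎
  where
  open ≡-Reasoning
  split : ∀ n a b → suc (suc n) * (a + b) ≡ suc n * a + (suc n * b + a + b)
  split = solve-∀
  merge : ∀ k p a b → suc (suc k) * p + (suc k * (a + b) + a + b) ≡ suc (suc k) * (p + (a + b))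
  merge = solve-∀

[1+n∸k]*[1+n]Ck≡[1+n]*nCk : ∀ n k → (suc n ∸ k) * (suc n C k) ≡ suc n * (n C k)
[1+n∸k]*[1+n]Ck≡[1+n]*nCk n zero    = refl
[1+n∸k]*[1+n]Ck≡[1+n]*nCk n (suc k) = begin
    (suc n ∸ suc k) * (suc n C suc k)
  ≡⟨ *-distribʳ-∸ (suc n C suc k) (suc n) (suc k) ⟩
    suc n * (suc n C suc k) ∸ suc k * (suc n C suc k)
  ≡⟨ cong₂ (λ u v → suc n * u ∸ v) (pascal n k) ([1+n]*nCk≡[1+k]*[1+n]C[1+k] n k) ⟨
    suc n * (n C suc k + n C k) ∸ suc n * (n C k)
  ≡⟨ cong (_∸ suc n * (n C k)) (*-distribˡ-+ (suc n) (n C suc k) (n C k)) ⟩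
    suc n * (n C suc k) + suc n * (n C k) ∸ suc n * (n C k)
  ≡⟨ m+n∸n≡m (suc n * (n C suc k)) (suc n * (n C k)) ⟩
    suc n * (n C suc k) ∎
  where open ≡-Reasoning

0<nCk : ∀ {n k} → k ≤ n → 0 < n C k
0<nCk {n}     {zero}  _         = s≤s z≤n
0<nCk {suc n} {suc k} (s≤s k≤n) =
  ≤-trans (0<nCk k≤n) (≤-trans (m≤n+m (n C k) (n C suc k)) (≤-reflexive (pascal n k)))

[1+n]*[[1+n]Ck∸nCk]≡k*[1+n]Ck : ∀ n k → k ≤ suc n → suc n * (suc n C k ∸ n C k) ≡ k * (suc n C k)
[1+n]*[[1+n]Ck∸nCk]≡k*[1+n]Ck n k k≤1+n = begin
    suc n * (suc n C k ∸ n C k)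
  ≡⟨ *-distribˡ-∸ (suc n) (suc n C k) (n C k) ⟩
    suc n * (suc n C k) ∸ suc n * (n C k)
  ≡⟨ cong (suc n * (suc n C k) ∸_) ([1+n∸k]*[1+n]Ck≡[1+n]*nCk n k) ⟨
    suc n * (suc n C k) ∸ (suc n ∸ k) * (suc n C k)
  ≡⟨ *-distribʳ-∸ (suc n C k) (suc n) (suc n ∸ k) ⟨
    (suc n ∸ (suc n ∸ k)) * (suc n C k)
  ≡⟨ cong (_* (suc n C k)) (m∸[m∸n]≡n k≤1+n) ⟩
    k * (suc n C k) ∎
  where open ≡-Reasoning

[2+n]*[1+n]*nCk≡[2+n∸k]*[1+n∸k]*[2+n]Ck : ∀ n k →
  suc (suc n) * suc n * (n C k) ≡ (suc (suc n) ∸ k) * (suc n ∸ k) * (suc (suc n) C k)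
[2+n]*[1+n]*nCk≡[2+n∸k]*[1+n∸k]*[2+n]Ck n k = sym (begin
    (suc (suc n) ∸ k) * (suc n ∸ k) * (suc (suc n) C k)
  ≡⟨ xy∙z≈y∙xz (suc (suc n) ∸ k) (suc n ∸ k) (suc (suc n) C k) ⟩
    (suc n ∸ k) * ((suc (suc n) ∸ k) * (suc (suc n) C k))
  ≡⟨ cong ((suc n ∸ k) *_) ([1+n∸k]*[1+n]Ck≡[1+n]*nCk (suc n) k) ⟩
    (suc n ∸ k) * (suc (suc n) * (suc n C k))
  ≡⟨ x∙yz≈y∙xz (suc n ∸ k) (suc (suc n)) (suc n C k) ⟩
    suc (suc n) * ((suc n ∸ k) * (suc n C k))
  ≡⟨ cong (suc (suc n) *_) ([1+n∸k]*[1+n]Ck≡[1+n]*nCk n k) ⟩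
    suc (suc n) * (suc n * (n C k))
  ≡⟨ *-assoc (suc (suc n)) (suc n) (n C k) ⟨
    suc (suc n) * suc n * (n C k) ∎)
  where
  open ≡-Reasoning
  open CommSemigroupProperties *-commutativeSemigroup using (xy∙z≈y∙xz; x∙yz≈y∙xz)

∑-laSize : ∀ {G d k} (T : Subtree G k) (c : V G → Fin d) → Proper G d c →
  ∀ L {A B} →
  (∀ a → ∑ L (λ S → ind (S a)) ≡ A) →
  (∀ a b → a ≢ b → ∑ L (λ S → ind (not (S a) ∧ not (S b))) ≡ B) →
  ∑ L (laSize T c) ≡ length L * numLeaves T + count (not ∘ isLeaf T) * A + numEdges (E T) * B
∑-laSize {d = d} {k} T c proper L {A} {B} ∑in≡A ∑out≡B = begin
    ∑ L (laSize T c)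
  ≡⟨ ∑-+ L (λ S → numLeaves T + count (λ i → nonLeaf i ∧ S (col i))) (λ S → edgesWith (E T) (outside S)) ⟩
    ∑ L (λ S → numLeaves T + count (λ i → nonLeaf i ∧ S (col i))) + ∑ L (λ S → edgesWith (E T) (outside S))
  ≡⟨ cong (_+ ∑ L (λ S → edgesWith (E T) (outside S)))
          (∑-+ L (λ _ → numLeaves T) (λ S → count (λ i → nonLeaf i ∧ S (col i)))) ⟩
    ∑ L (λ _ → numLeaves T) + ∑ L (λ S → count (λ i → nonLeaf i ∧ S (col i)))
      + ∑ L (λ S → edgesWith (E T) (outside S))
  ≡⟨ cong₂ _+_ (cong₂ _+_ (∑-const L (numLeaves T)) ∑vertices) ∑edges ⟩
    length L * numLeaves T + count nonLeaf * A + numEdges (E T) * B ∎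
  where
  open ≡-Reasoning
  col : Fin k → Fin d
  col i = c (vert T i)
  nonLeaf : Fin k → Bool
  nonLeaf = not ∘ isLeaf T
  outside : (Fin d → Bool) → Fin k → Fin k → Bool
  outside S i j = not (S (col i)) ∧ not (S (col j))
  lt : Fin k → Fin k → Bool
  lt i j = does (i <? j)

  ∑vertices : ∑ L (λ S → count (λ i → nonLeaf i ∧ S (col i))) ≡ count nonLeaf * A
  ∑vertices = ∑-count-∧ L nonLeaf (λ S i → S (col i)) (λ i _ → ∑in≡A (col i))

  ∧-reassoc : ∀ a b c → a ∧ b ∧ c ≡ (a ∧ b ∧ true) ∧ c
  ∧-reassoc true  true  c = refl
  ∧-reassoc true  false c = refl
  ∧-reassoc false b     c = refl

  middle-true : ∀ a b → a ∧ b ∧ true ≡ true → b ≡ true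
  middle-true true true _ = refl

  ∑edgesAt : ∀ i → ∑ L (λ S → count (λ j → lt i j ∧ E T i j ∧ outside S i j))
                   ≡ count (λ j → lt i j ∧ E T i j ∧ true) * B
  ∑edgesAt i =
    trans (∑-cong L (λ S → count-cong (λ j → ∧-reassoc (lt i j) (E T i j) (outside S i j))))
          (∑-count-∧ L (λ j → lt i j ∧ E T i j ∧ true) (λ S j → outside S i j)
             (λ j e → ∑out≡B (col i) (col j) (proper (E-sub T i j (middle-true (lt i j) (E T i j) e)))))

  ∑edges : ∑ L (λ S → edgesWith (E T) (outside S)) ≡ numEdges (E T) * B
  ∑edges = begin
      ∑ L (λ S → edgesWith (E T) (outside S))
    ≡⟨ ∑-sumF-comm L (λ S i → count (λ j → lt i j ∧ E T i j ∧ outside S i j)) ⟩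
      sumF (λ i → ∑ L (λ S → count (λ j → lt i j ∧ E T i j ∧ outside S i j)))
    ≡⟨ sumF-cong ∑edgesAt ⟩
      sumF (λ i → count (λ j → lt i j ∧ E T i j ∧ true) * B)
    ≡⟨ sumF-*ʳ (λ i → count (λ j → lt i j ∧ E T i j ∧ true)) B ⟩
      numEdges (E T) * B ∎

[1+m∸k]*[m∸k]+k*[1+m∸k]≡[1+m∸k]*m : ∀ m k → k ≤ suc m →
  (suc m ∸ k) * (m ∸ k) + k * (suc m ∸ k) ≡ (suc m ∸ k) * m
[1+m∸k]*[m∸k]+k*[1+m∸k]≡[1+m∸k]*m m k k≤1+m = begin
    (suc m ∸ k) * (m ∸ k) + k * (suc m ∸ k)
  ≡⟨ cong ((suc m ∸ k) * (m ∸ k) +_) (*-comm k (suc m ∸ k)) ⟩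
    (suc m ∸ k) * (m ∸ k) + (suc m ∸ k) * k
  ≡⟨ *-distribˡ-+ (suc m ∸ k) (m ∸ k) k ⟨
    (suc m ∸ k) * (m ∸ k + k)
  ≡⟨ drop-truncation (m≤n⇒m<n∨m≡n k≤1+m) ⟩
    (suc m ∸ k) * m ∎
  where
  open ≡-Reasoning
  drop-truncation : k < suc m ⊎ k ≡ suc m → (suc m ∸ k) * (m ∸ k + k) ≡ (suc m ∸ k) * m
  drop-truncation (inj₁ (s≤s k≤m)) = cong ((suc m ∸ k) *_) (m∸n+n≡m k≤m)
  drop-truncation (inj₂ refl)      =
    trans (cong (_* (m ∸ suc m + suc m)) (n∸n≡0 m)) (cong (_* m) (sym (n∸n≡0 m)))

-- N = C(d,x) subsets, each vertex colour lies in A of them and each pair of distinct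
-- colours is avoided by B of them; multiplying by d(d-1) turns A and B into multiples of N.
averaging-bound : ∀ {d D1 x y z N A B l m e k la} .{{_ : NonZero N}} →
  x + y ≡ d → m + l ≡ k → e ≤ k →
  d * A ≡ x * N → d * D1 * B ≡ y * z * N → y * z + x * y ≡ y * D1 →
  N * la ≤ N * l + m * A + e * B →
  d * D1 * la + x * y * k ≤ d * D1 * k + D1 * y * l
averaging-bound {D1 = D1} {x} {y} {z} {N} {A} {B} {l} {m} {e} {la = la}
                refl refl e≤k dA≡xN dD1B≡yzN yz+xy≡yD1 N*la≤ = *-cancelˡ-≤ N (begin
    N * (d * D1 * la + x * y * k)
  ≡⟨ expand N d D1 la (x * y) k ⟩
    d * D1 * (N * la) + N * (x * y) * k
  ≤⟨ +-monoˡ-≤ (N * (x * y) * k) (*-monoʳ-≤ (d * D1) N*la≤) ⟩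
    d * D1 * (N * l + m * A + e * B) + N * (x * y) * k
  ≡⟨ regroup d D1 N l m A e B (N * (x * y) * k) ⟩
    N * (d * D1 * l) + D1 * m * (d * A) + d * D1 * B * e + N * (x * y) * k
  ≡⟨ cong₂ (λ u v → N * (d * D1 * l) + D1 * m * u + v * e + N * (x * y) * k) dA≡xN dD1B≡yzN ⟩
    N * (d * D1 * l) + D1 * m * (x * N) + y * z * N * e + N * (x * y) * k
  ≤⟨ +-monoˡ-≤ (N * (x * y) * k) (+-monoʳ-≤ (N * (d * D1 * l) + D1 * m * (x * N)) (*-monoʳ-≤ (y * z * N) e≤k)) ⟩
    N * (d * D1 * l) + D1 * m * (x * N) + y * z * N * k + N * (x * y) * k
  ≡⟨ factor N (d * D1 * l) D1 m x (y * z) (x * y) k ⟩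
    N * (d * D1 * l + D1 * m * x + (y * z + x * y) * k)
  ≡⟨ cong (λ u → N * (d * D1 * l + D1 * m * x + u * k)) yz+xy≡yD1 ⟩
    N * (d * D1 * l + D1 * m * x + y * D1 * k)
  ≡⟨ cong (N *_) (collect x y D1 m l) ⟩
    N * (d * D1 * k + D1 * y * l) ∎)
  where
  open ≤-Reasoning
  d k : ℕ
  d = x + y
  k = m + l
  expand : ∀ N a b c p q → N * (a * b * c + p * q) ≡ a * b * (N * c) + N * p * q
  expand = solve-∀
  regroup : ∀ d D1 N l m A e B r → d * D1 * (N * l + m * A + e * B) + r
                                 ≡ N * (d * D1 * l) + D1 * m * (d * A) + d * D1 * B * e + r
  regroup = solve-∀
  factor : ∀ N a D1 m x p q k → N * a + D1 * m * (x * N) + p * N * k + N * q * k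
                               ≡ N * (a + D1 * m * x + (p + q) * k)
  factor = solve-∀
  collect : ∀ x y D1 m l → (x + y) * D1 * l + D1 * m * x + y * D1 * (m + l)
                         ≡ (x + y) * D1 * (m + l) + D1 * y * l
  collect = solve-∀

la-bound : ∀ {G} n (c : V G → Fin (2 + n)) → Proper G (2 + n) c → ∀ {k} (T : Subtree G k) x → x ≤ 2 + n →
  Σ (Fin (2 + n) → Bool) λ S → count S ≡ x ×
    (2 + n) * (1 + n) * laSize T c S + x * (2 + n ∸ x) * k
      ≤ (2 + n) * (1 + n) * k + (1 + n) * (2 + n ∸ x) * numLeaves T
la-bound n c proper {k} T x x≤d
  with length*argmin≤∑ (laSize T c) (subsetsOfSize (2 + n) x) 0<length (count-subsetsOfSize (2 + n) x)
  where
  0<length : 0 < length (subsetsOfSize (2 + n) x)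
  0<length = subst (0 <_) (sym (length-subsetsOfSize (2 + n) x)) (0<nCk x≤d)
... | S , count≡x , length*la≤∑ = S , count≡x ,
  averaging-bound {D1 = 1 + n} {x} {2 + n ∸ x} {1 + n ∸ x} {{>-nonZero (0<nCk x≤d)}}
    (m+[n∸m]≡n x≤d) (count-not+count (isLeaf T)) e≤k
    ([1+n]*[[1+n]Ck∸nCk]≡k*[1+n]Ck (suc n) x x≤d) ([2+n]*[1+n]*nCk≡[2+n∸k]*[1+n∸k]*[2+n]Ck n x)
    ([1+m∸k]*[m∸k]+k*[1+m∸k]≡[1+m∸k]*m (suc n) x x≤d)
    (subst₂ _≤_ (cong (_* laSize T c S) length≡N) ∑≡ length*la≤∑)
  where
  L : List (Fin (2 + n) → Bool)
  L = subsetsOfSize (2 + n) x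
  length≡N : length L ≡ (2 + n) C x
  length≡N = length-subsetsOfSize (2 + n) x
  e≤k : numEdges (E T) ≤ k
  e≤k = ≤-trans (m≤m+n (numEdges (E T)) 1) (≤-reflexive (edges T))
  ∑≡ : ∑ L (laSize T c) ≡ ((2 + n) C x) * numLeaves T + count (not ∘ isLeaf T) * ((2 + n) C x ∸ (1 + n) C x)
                          + numEdges (E T) * (n C x)
  ∑≡ = trans (∑-laSize T c proper L (∑-containing (suc n) x) (∑-avoiding₂ n x))
             (cong (λ N → N * numLeaves T + count (not ∘ isLeaf T) * ((2 + n) C x ∸ (1 + n) C x)
                                 + numEdges (E T) * (n C x)) length≡N)

x≤d-of-rounding : ∀ {D1 k l x} .{{_ : NonZero k}} → l ≤ k →
  2 * k * x ≤ suc D1 * k + l * D1 + k → x ≤ suc D1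
x≤d-of-rounding {D1} {k} {l} {x} l≤k 2kx≤ = *-cancelˡ-≤ (2 * k) {{m*n≢0 2 k}} (begin
    2 * k * x                  ≤⟨ 2kx≤ ⟩
    suc D1 * k + l * D1 + k    ≤⟨ +-monoˡ-≤ k (+-monoʳ-≤ (suc D1 * k) (*-monoˡ-≤ D1 l≤k)) ⟩
    suc D1 * k + k * D1 + k    ≡⟨ rearrange D1 k ⟩
    2 * k * suc D1             ∎)
  where
  open ≤-Reasoning
  rearrange : ∀ D1 k → suc D1 * k + k * D1 + k ≡ 2 * k * suc D1
  rearrange = solve-∀

la-bound-balanced : ∀ {G} n (c : V G → Fin (2 + n)) → Proper G (2 + n) c → ∀ {k} (T : Subtree G k) →
  Σ (Fin (2 + n) → Bool) λ S →
    2 * (2 + n) * (1 + n) * laSize T c S + 2 * (((2 + n) / 2) * (2 + n ∸ (2 + n) / 2)) * k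
      ≤ 2 * (2 + n) * (1 + n) * k + (2 + n) * (1 + n) * numLeaves T
la-bound-balanced n c proper {k} T
  with la-bound n c proper T (2 + n ∸ (2 + n) / 2) (m∸n≤m (2 + n) ((2 + n) / 2))
... | S , _ , bound = S , (begin
    2 * d * D1 * la + 2 * (h * x) * k
  ≡⟨ double d D1 la h x k ⟩
    2 * (d * D1 * la + x * h * k)
  ≤⟨ *-monoʳ-≤ 2 (subst (λ y → d * D1 * la + x * y * k ≤ d * D1 * k + D1 * y * l) d∸x≡h bound) ⟩
    2 * (d * D1 * k + D1 * h * l)
  ≡⟨ distribute d D1 k h l ⟩
    2 * d * D1 * k + D1 * l * (2 * h)
  ≤⟨ +-monoʳ-≤ (2 * d * D1 * k) (*-monoʳ-≤ (D1 * l) 2h≤d) ⟩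
    2 * d * D1 * k + D1 * l * d
  ≡⟨ cong (2 * d * D1 * k +_) (xy∙z≈zx∙y D1 l d) ⟩
    2 * d * D1 * k + d * D1 * l ∎)
  where
  open ≤-Reasoning
  open CommSemigroupProperties *-commutativeSemigroup using (xy∙z≈zx∙y)
  d D1 h x l la : ℕ
  d = 2 + n
  D1 = 1 + n
  h = d / 2
  x = d ∸ h
  l = numLeaves T
  la = laSize T c S
  d∸x≡h : d ∸ x ≡ h
  d∸x≡h = m∸[m∸n]≡n (m/n≤m d 2)
  2h≤d : 2 * h ≤ d
  2h≤d = ≤-trans (≤-reflexive (*-comm 2 h)) (m/n*n≤m d 2)
  double : ∀ d D1 la h x k → 2 * d * D1 * la + 2 * (h * x) * k ≡ 2 * (d * D1 * la + x * h * k)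
  double = solve-∀
  distribute : ∀ d D1 k h l → 2 * (d * D1 * k + D1 * h * l) ≡ 2 * d * D1 * k + D1 * l * (2 * h)
  distribute = solve-∀

lemma13 : (G : Graph) (d : ℕ) → 2 ≤ d → (c : V G → Fin d) → Proper G d c →
          (k l : ℕ) → 1 ≤ k → (T : Subtree G k) → numLeaves T ≡ l →
          ((x : ℕ) →
            2 * k * x ≤ d * k + l * (d ∸ 1) + k →
            d * k + l * (d ∸ 1) ≤ 2 * k * x + k →
            Σ (Fin d → Bool) λ S → count S ≡ x ×
              d * (d ∸ 1) * laSize T c S + x * (d ∸ x) * k
                ≤ d * (d ∸ 1) * k + (d ∸ 1) * (d ∸ x) * l)
          × Σ (Fin d → Bool) λ S →
              2 * d * (d ∸ 1) * laSize T c S + 2 * ((d / 2) * (d ∸ d / 2)) * k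
                ≤ 2 * d * (d ∸ 1) * k + d * (d ∸ 1) * l
lemma13 G zero          ()        _ _      _       _ _ _ _
lemma13 G (suc zero)    (s≤s ())  _ _      _       _ _ _ _
lemma13 G (suc (suc n)) _         c proper (suc k) _ _ T refl =
  (λ x 2kx≤ _ → la-bound n c proper T x (x≤d-of-rounding leaves≤k 2kx≤)) ,
  la-bound-balanced n c proper T
  where
  leaves≤k : numLeaves T ≤ suc k
  leaves≤k = ≤-trans (m≤n+m (numLeaves T) (count (not ∘ isLeaf T))) (≤-reflexive (count-not+count (isLeaf T)))
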